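{- Let $i$ be a positive integer and let $G'$ be the threshold graph with binary sequence $(0\, 1^{2i}0^{i+1} 1^{2i} 0^{2i+1} 1^{2i+2})$ (so $G'$ has $9i+5$ vertices). Then, to within a sign, the characteristic polynomial of (the adjacency matrix of) $G'$ is $$P_{G'}(x) = x^{3i} (x+1)^{6i} (x+2i+2)\left(x^4 -(8i+2)x^3 -(-8i^2+4i+3)x^2 -(-8i^3 -20i^2-8i)x -8i^4-12i^3-4i^2\right).$$
   Context: A threshold graph on $N$ vertices is coded by a binary sequence $(b_1 b_2 \ldots b_N)$ with $b_1=0$: vertices $v_1,\dots,v_N$ are added in order, and for $j\ge 2$ the vertex $v_j$ is added as an isolated vertex if $b_j=0$ and as a dominating vertex (adjacent to all of $v_1,\dots,v_{j-1}$) if $b_j=1$. Thus for $k<j$, $v_k$ is adjacent to $v_j$ iff $b_j=1$. The notation $(0\,1^{a_2} 0^{a_3} 1^{a_4}\cdots)$ denotes the sequence consisting of one zero, followed by $a_2$ ones, followed by $a_3$ zeros, etc. The characteristic polynomial of a graph is that of its adjacency matrix. -}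

module Defs where

open import Data.Bool using (Bool; true; false; if_then_else_)
open import Data.Nat as ℕ using (ℕ; zero; suc)
open import Data.Integer using (ℤ; +_; -_; _+_; _-_; _*_; _^_)
open import Data.Fin using (Fin; zero; suc; toℕ; punchIn)
open import Data.List using (List; _∷_; []; length; lookup; replicate; _++_)

sumFin : (n : ℕ) → (Fin n → ℤ) → ℤ
sumFin zero    f = + 0
sumFin (suc n) f = f zero + sumFin n (λ j → f (suc j))

sgn : ℕ → ℤ
sgn zero          = + 1
sgn (suc zero)    = - (+ 1)
sgn (suc (suc k)) = sgn k

det : (n : ℕ) → (Fin n → Fin n → ℤ) → ℤ
det zero    M = + 1
det (suc n) M =
  sumFin (suc n) (λ j → sgn (toℕ j) * (M zero j * det n (λ r c → M (suc r) (punchIn j c))))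

-- Threshold graph coded by a binary sequence bs = (b_1 ... b_N) (true = 1, false = 0);
-- its vertices are indexed by Fin N (index k stands for v_{k+1}).
thresholdAdj : (bs : List Bool) → Fin (length bs) → Fin (length bs) → Bool
thresholdAdj bs k j =
  if toℕ k ℕ.<ᵇ toℕ j then lookup bs j
  else if toℕ j ℕ.<ᵇ toℕ k then lookup bs k
  else false

adjMatrix : (bs : List Bool) → Fin (length bs) → Fin (length bs) → ℤ
adjMatrix bs k j = if thresholdAdj bs k j then + 1 else + 0

charPoly : (n : ℕ) → (Fin n → Fin n → ℤ) → ℤ → ℤ
charPoly n A x = det n (λ r c → (if toℕ r ℕ.≡ᵇ toℕ c then x else + 0) - A r c)

thresholdCharPoly : List Bool → ℤ → ℤ
thresholdCharPoly bs = charPoly (length bs) (adjMatrix bs)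

seqG' : ℕ → List Bool
seqG' i = false ∷ (replicate (2 ℕ.* i) true ++ (replicate (i ℕ.+ 1) false ++
           (replicate (2 ℕ.* i) true ++ (replicate (2 ℕ.* i ℕ.+ 1) false ++
            replicate (2 ℕ.* i ℕ.+ 2) true))))

rhsG' : ℕ → ℤ → ℤ
rhsG' i x =
  (x ^ (3 ℕ.* i)) * ((x + + 1) ^ (6 ℕ.* i)) * (x + (+ 2 * n + + 2)) *
  ( x ^ 4
  - (+ 8 * n + + 2) * x ^ 3
  - (- (+ 8) * n ^ 2 + + 4 * n + + 3) * x ^ 2
  - (- (+ 8) * n ^ 3 - + 20 * n ^ 2 - + 8 * n) * x
  - + 8 * n ^ 4 - + 12 * n ^ 3 - + 4 * n ^ 2 )
  where n = + i

-- Subtracting row 2 of x I - A from row 1 and expanding along the difference gives the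
-- recurrence P(b₁ b₂ t) = (x + b₂) (2 P(b₂ t) - (x + b₂) P(t)), which does not see b₁. Along a
-- run of equal bits c this is a linear recurrence with the double root a = x + c, so the run
-- c^(m+1) transforms the pair (P(0 t), P(t)) into a^m times an explicit polynomial map of it.
-- The five runs of G' contribute the factor x^(3i) (x + 1)^(6i - 1), and composing their five
-- polynomial maps gives (x + 1) (x + 2i + 2) times the quartic.
module Submission where

open import Defs
open import Data.Nat as ℕ using (ℕ; zero; suc; _≥_)
open import Data.Nat.Tactic.RingSolver renaming (solve-∀ to ℕ-solve-∀)
open import Data.Integer using (ℤ; +_; -[1+_]; -_; _+_; _-_; _*_; _^_)
open import Data.Integer.Properties
  using ( +-*-semiring; +-identityˡ; +-identityʳ; +-inverseʳ; *-identityˡ; *-zeroˡ; *-zeroʳ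
        ; *-assoc; -1*i≡-i; ^-distribˡ-+-* )
open import Data.Integer.Tactic.RingSolver using (solve-∀)
open import Data.Fin using (Fin; zero; suc; toℕ; punchIn; punchOut)
open import Data.Fin.Properties
  using (_≟_; punchInᵢ≢i; punchOut-cong; punchOut-punchIn; punchIn-punchOut)
open import Data.Vec.Functional as Vec using (map; removeAt; tail)
open import Algebra.Properties.Semiring.Sum +-*-semiring
  using (sum; sum-cong-≗; sum-remove; sum-replicate-zero; ∑-comm; ∑-distrib-+; *-distribˡ-sum)
open import Data.Bool using (Bool; true; false; if_then_else_)
open import Data.List using (List; _∷_; []; length; replicate; _++_)
open import Data.List.Properties using (++-identityʳ)
open import Data.Product using (Σ; _×_; _,_; proj₁; proj₂)
open import Data.Sum using (_⊎_; inj₁)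
open import Function using (_∘_)
open import Relation.Nullary using (yes; no; contradiction)
open import Relation.Binary.PropositionalEquality

Matrix : ℕ → Set
Matrix n = Fin n → Fin n → ℤ

minor : ∀ {n} → Fin (suc n) → Matrix (suc n) → Matrix n
minor j M r c = M (suc r) (punchIn j c)

sumFin≡sum : ∀ n (f : Fin n → ℤ) → sumFin n f ≡ sum f
sumFin≡sum zero    f = refl
sumFin≡sum (suc n) f = cong (_+_ (f zero)) (sumFin≡sum n (f ∘ suc))

sumFin-cong : ∀ n {f g : Fin n → ℤ} → (∀ j → f j ≡ g j) → sumFin n f ≡ sumFin n g
sumFin-cong zero    f≗g = refl
sumFin-cong (suc n) f≗g = cong₂ _+_ (f≗g zero) (sumFin-cong n (f≗g ∘ suc))

det-cong : ∀ n {A B : Matrix n} → (∀ r c → A r c ≡ B r c) → det n A ≡ det n B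
det-cong zero    A≗B = refl
det-cong (suc n) A≗B = sumFin-cong (suc n) λ j →
  cong (sgn (toℕ j) *_) (cong₂ _*_ (A≗B zero j) (det-cong n (λ r c → A≗B (suc r) (punchIn j c))))

sgn-suc : ∀ m → sgn (suc m) ≡ - sgn m
sgn-suc zero          = refl
sgn-suc (suc zero)    = refl
sgn-suc (suc (suc m)) = sgn-suc m

punchIn-punchOut-comm : ∀ {n} {j j' : Fin (suc (suc n))} (j≢j' : j ≢ j') (j'≢j : j' ≢ j) (c : Fin n) →
  punchIn j (punchIn (punchOut j≢j') c) ≡ punchIn j' (punchIn (punchOut j'≢j) c)
punchIn-punchOut-comm {j = zero}  {zero}   j≢j' _ c = contradiction refl j≢j'
punchIn-punchOut-comm {j = zero}  {suc j'} _    _ c = refl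
punchIn-punchOut-comm {j = suc j} {zero}   _    _ c = refl
punchIn-punchOut-comm {zero}  {suc zero} {suc zero} j≢j' _ c = contradiction refl j≢j'
punchIn-punchOut-comm {suc n} {suc j} {suc j'} _ _ zero = refl
punchIn-punchOut-comm {suc n} {suc j} {suc j'} j≢j' j'≢j (suc c) =
  cong suc (punchIn-punchOut-comm (j≢j' ∘ cong suc) (j'≢j ∘ cong suc) c)

sgn-suc-* : ∀ a b → sgn (suc a) * sgn (suc b) ≡ sgn a * sgn b
sgn-suc-* a b rewrite sgn-suc a | sgn-suc b = neg-* (sgn a) (sgn b)
  where
  neg-* : ∀ s t → - s * - t ≡ s * t
  neg-* = solve-∀

-- Of the two orders of deleting columns j and j', exactly one shifts the second index.
sgn-punchOut-swap : ∀ {n} {j j' : Fin (suc (suc n))} (j≢j' : j ≢ j') (j'≢j : j' ≢ j) →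
  sgn (toℕ j) * sgn (toℕ (punchOut j≢j')) ≡ - (sgn (toℕ j') * sgn (toℕ (punchOut j'≢j)))
sgn-punchOut-swap {j = zero}  {zero}   j≢j' _ = contradiction refl j≢j'
sgn-punchOut-swap {j = zero}  {suc j'} _    _ rewrite sgn-suc (toℕ j') = flip (sgn (toℕ j'))
  where
  flip : ∀ s → + 1 * s ≡ - (- s * + 1)
  flip = solve-∀
sgn-punchOut-swap {j = suc j} {zero}   _    _ rewrite sgn-suc (toℕ j) = flip (sgn (toℕ j))
  where
  flip : ∀ s → - s * + 1 ≡ - (+ 1 * s)
  flip = solve-∀
sgn-punchOut-swap {zero}  {suc zero} {suc zero} j≢j' _ = contradiction refl j≢j'
sgn-punchOut-swap {suc n} {suc j} {suc j'} j≢j' j'≢j = begin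
  sgn (suc (toℕ j)) * sgn (suc (toℕ (punchOut j≢j'′)))    ≡⟨ sgn-suc-* (toℕ j) (toℕ (punchOut j≢j'′)) ⟩
  sgn (toℕ j) * sgn (toℕ (punchOut j≢j'′))                ≡⟨ sgn-punchOut-swap j≢j'′ j'≢j′ ⟩
  - (sgn (toℕ j') * sgn (toℕ (punchOut j'≢j′)))           ≡⟨ cong -_ (sym (sgn-suc-* (toℕ j') (toℕ (punchOut j'≢j′)))) ⟩
  - (sgn (suc (toℕ j')) * sgn (suc (toℕ (punchOut j'≢j′)))) ∎
  where
  open ≡-Reasoning
  j≢j'′ : j ≢ j'
  j≢j'′ = j≢j' ∘ cong suc
  j'≢j′ : j' ≢ j
  j'≢j′ = j'≢j ∘ cong suc

sum-neg : ∀ {n} (f : Fin n → ℤ) → sum (λ j → - f j) ≡ - sum f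
sum-neg f = begin
  sum (λ j → - f j)        ≡⟨ sum-cong-≗ (λ j → sym (-1*i≡-i (f j))) ⟩
  sum (map (- + 1 *_) f)   ≡⟨ sym (*-distribˡ-sum (- + 1) f) ⟩
  - + 1 * sum f            ≡⟨ -1*i≡-i (sum f) ⟩
  - sum f                  ∎
  where open ≡-Reasoning

i≡-i⇒i≡0 : ∀ i → i ≡ - i → i ≡ + 0
i≡-i⇒i≡0 (+ zero)  _  = refl
i≡-i⇒i≡0 (+ suc n) ()
i≡-i⇒i≡0 -[1+ n ]  ()

-- Expanding along the two equal rows pairs the term choosing columns (j, j') with the term
-- choosing (j', j); the two cancel, so the determinant equals its own negative.
det-repeatedRow : ∀ n (M : Matrix (suc (suc n))) → (∀ c → M zero c ≡ M (suc zero) c) →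
  det (suc (suc n)) M ≡ + 0
det-repeatedRow n M row₀≡row₁ = i≡-i⇒i≡0 (det N M) (begin
  det N M                                    ≡⟨ expansion ⟩
  sum (λ j → sum (term j))                   ≡⟨ ∑-comm term ⟩
  sum (λ j' → sum (λ j → term j j'))         ≡⟨ sum-cong-≗ (λ j' → sum-cong-≗ (λ j → term-antisym j j')) ⟩
  sum (λ j' → sum (λ j → - term j' j))       ≡⟨ sum-cong-≗ (λ j' → sum-neg (term j')) ⟩
  sum (λ j' → - sum (term j'))               ≡⟨ sum-neg (λ j' → sum (term j')) ⟩
  - sum (λ j → sum (term j))                 ≡⟨ cong -_ (sym expansion) ⟩
  - det N M                                  ∎)
  where
  open ≡-Reasoning
  N : ℕ
  N = suc (suc n)
  u : Fin N → ℤ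
  u = M (suc zero)
  D : (Fin n → Fin N) → ℤ
  D cols = det n (λ r c → M (suc (suc r)) (cols c))

  body : Fin N → Fin (suc n) → ℤ
  body j k = sgn (toℕ j) * sgn (toℕ k) * (u j * u (punchIn j k) * D (punchIn j ∘ punchIn k))

  term : Fin N → Fin N → ℤ
  term j j' with j ≟ j'
  ... | yes _    = + 0
  ... | no j≢j' = body j (punchOut j≢j')

  term-diag : ∀ j → term j j ≡ + 0
  term-diag j with j ≟ j
  ... | yes _   = refl
  ... | no j≢j = contradiction refl j≢j

  term-punchIn : ∀ j k → term j (punchIn j k) ≡ body j k
  term-punchIn j k with j ≟ punchIn j k
  ... | yes j≡ = contradiction (sym j≡) (punchInᵢ≢i j k)
  ... | no j≢ = cong (body j) (trans (punchOut-cong j refl) (punchOut-punchIn j))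

  term-antisym : ∀ j' j → term j' j ≡ - term j j'
  term-antisym j' j with j ≟ j' | j' ≟ j
  ... | yes _    | yes _    = refl
  ... | yes j≡j' | no j'≢j = contradiction (sym j≡j') j'≢j
  ... | no j≢j'  | yes j'≡j = contradiction (sym j'≡j) j≢j'
  ... | no j≢j'  | no j'≢j = begin
    σ' * (u j' * u (punchIn j' (punchOut j'≢j)) * D (punchIn j' ∘ punchIn (punchOut j'≢j)))
      ≡⟨ cong₂ (λ x y → σ' * (u j' * u x * y)) (punchIn-punchOut j'≢j)
           (det-cong n (λ r c → cong (M (suc (suc r))) (sym (punchIn-punchOut-comm j≢j' j'≢j c)))) ⟩
    σ' * (u j' * u j * D (punchIn j ∘ punchIn (punchOut j≢j')))
      ≡⟨ swap-sign (u j') (u j) (D (punchIn j ∘ punchIn (punchOut j≢j'))) (sgn-punchOut-swap j≢j' j'≢j) ⟩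
    - (σ * (u j * u j' * D (punchIn j ∘ punchIn (punchOut j≢j'))))
      ≡⟨ cong (λ x → - (σ * (u j * u x * D (punchIn j ∘ punchIn (punchOut j≢j'))))) (sym (punchIn-punchOut j≢j')) ⟩
    - (σ * (u j * u (punchIn j (punchOut j≢j')) * D (punchIn j ∘ punchIn (punchOut j≢j')))) ∎
    where
    σ σ' : ℤ
    σ  = sgn (toℕ j) * sgn (toℕ (punchOut j≢j'))
    σ' = sgn (toℕ j') * sgn (toℕ (punchOut j'≢j))
    swap-sign : ∀ {s s'} a b d → s ≡ - s' → s' * (a * b * d) ≡ - (s * (b * a * d))
    swap-sign {s' = s'} a b d refl = lemma s' a b d
      where
      lemma : ∀ s a b d → s * (a * b * d) ≡ - (- s * (b * a * d))
      lemma = solve-∀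

  expansion : det N M ≡ sum (λ j → sum (term j))
  expansion =
    trans (sumFin≡sum N (λ j → sgn (toℕ j) * (M zero j * det (suc n) (minor j M)))) (sum-cong-≗ row-expansion)
    where
    row-expansion : ∀ j → sgn (toℕ j) * (M zero j * det (suc n) (minor j M)) ≡ sum (term j)
    row-expansion j = begin
      sgn (toℕ j) * (M zero j * sumFin (suc n) X)   ≡⟨ cong (λ x → sgn (toℕ j) * (x * sumFin (suc n) X)) (row₀≡row₁ j) ⟩
      sgn (toℕ j) * (u j * sumFin (suc n) X)        ≡⟨ sym (*-assoc (sgn (toℕ j)) (u j) _) ⟩
      sgn (toℕ j) * u j * sumFin (suc n) X          ≡⟨ cong (sgn (toℕ j) * u j *_) (sumFin≡sum (suc n) X) ⟩
      sgn (toℕ j) * u j * sum X                     ≡⟨ *-distribˡ-sum (sgn (toℕ j) * u j) X ⟩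
      sum (map (sgn (toℕ j) * u j *_) X)            ≡⟨ sum-cong-≗ (λ k → trans (regroup k) (sym (term-punchIn j k))) ⟩
      sum (removeAt (term j) j)                     ≡⟨ sym (+-identityˡ _) ⟩
      + 0 + sum (removeAt (term j) j)               ≡⟨ cong (_+ sum (removeAt (term j) j)) (sym (term-diag j)) ⟩
      term j j + sum (removeAt (term j) j)          ≡⟨ sym (sum-remove (term j)) ⟩
      sum (term j)                                  ∎
      where
      X : Fin (suc n) → ℤ
      X k = sgn (toℕ k) * (u (punchIn j k) * D (punchIn j ∘ punchIn k))
      regroup : ∀ k → sgn (toℕ j) * u j * X k ≡ body j k
      regroup k = reorder (sgn (toℕ j)) (u j) (sgn (toℕ k)) (u (punchIn j k)) (D (punchIn j ∘ punchIn k))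
        where
        reorder : ∀ s a t b d → s * a * (t * (b * d)) ≡ s * t * (a * b * d)
        reorder = solve-∀

det-head-+ : ∀ m (v w : Fin (suc m) → ℤ) (R : Fin m → Fin (suc m) → ℤ) →
  det (suc m) ((λ c → v c + w c) Vec.∷ R) ≡ det (suc m) (v Vec.∷ R) + det (suc m) (w Vec.∷ R)
det-head-+ m v w R = begin
  sumFin (suc m) (λ j → cofactor j (v j + w j))
    ≡⟨ sumFin≡sum (suc m) (λ j → cofactor j (v j + w j)) ⟩
  sum (λ j → cofactor j (v j + w j))
    ≡⟨ sum-cong-≗ (λ j → distrib (sgn (toℕ j)) (v j) (w j) (minorDet j)) ⟩
  sum (λ j → cofactor j (v j) + cofactor j (w j))
    ≡⟨ ∑-distrib-+ (λ j → cofactor j (v j)) (λ j → cofactor j (w j)) ⟩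
  sum (λ j → cofactor j (v j)) + sum (λ j → cofactor j (w j))
    ≡⟨ sym (cong₂ _+_ (sumFin≡sum (suc m) (λ j → cofactor j (v j))) (sumFin≡sum (suc m) (λ j → cofactor j (w j)))) ⟩
  sumFin (suc m) (λ j → cofactor j (v j)) + sumFin (suc m) (λ j → cofactor j (w j)) ∎
  where
  open ≡-Reasoning
  minorDet : Fin (suc m) → ℤ
  minorDet j = det m (λ r c → R r (punchIn j c))
  cofactor : Fin (suc m) → ℤ → ℤ
  cofactor j a = sgn (toℕ j) * (a * minorDet j)
  distrib : ∀ s a b d → s * ((a + b) * d) ≡ s * (a * d) + s * (b * d)
  distrib = solve-∀

det-subtractRow : ∀ n (M : Matrix (suc (suc n))) →
  det (suc (suc n)) M ≡ det (suc (suc n)) ((λ c → M zero c - M (suc zero) c) Vec.∷ tail M)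
det-subtractRow n M = begin
  det N M                                                     ≡⟨ det-cong N split ⟩
  det N ((λ c → w c + M (suc zero) c) Vec.∷ tail M)           ≡⟨ det-head-+ (suc n) w (M (suc zero)) (tail M) ⟩
  det N (w Vec.∷ tail M) + det N (M (suc zero) Vec.∷ tail M)
    ≡⟨ cong (_+_ (det N (w Vec.∷ tail M))) (det-repeatedRow n (M (suc zero) Vec.∷ tail M) (λ _ → refl)) ⟩
  det N (w Vec.∷ tail M) + + 0                                ≡⟨ +-identityʳ _ ⟩
  det N (w Vec.∷ tail M)                                      ∎
  where
  open ≡-Reasoning
  N : ℕ
  N = suc (suc n)
  w : Fin N → ℤ
  w c = M zero c - M (suc zero) c
  sub-add : ∀ a b → a ≡ (a - b) + b
  sub-add = solve-∀
  split : ∀ r c → M r c ≡ ((λ c → w c + M (suc zero) c) Vec.∷ tail M) r c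
  split zero    c = sub-add (M zero c) (M (suc zero) c)
  split (suc r) c = refl

det-corner : ∀ m (A B : Matrix (suc m)) →
  (∀ r c → A (suc r) c ≡ B (suc r) c) → (∀ c → A zero (suc c) ≡ B zero (suc c)) →
  det (suc m) A ≡ det (suc m) B + (A zero zero - B zero zero) * det m (minor zero B)
det-corner m A B rows cols =
  trans (cong₂ (λ d s → + 1 * (A zero zero * d) + s) (det-cong m (λ r c → rows r (suc c)))
          (sumFin-cong m (λ j → cong₂ (λ a d → sgn (toℕ (suc j)) * (a * d)) (cols j)
             (det-cong m (λ r c → rows r (punchIn (suc j) c))))))
        (shift (A zero zero) (B zero zero) (det m (minor zero B)) _)
  where
  shift : ∀ a b d rest → + 1 * (a * d) + rest ≡ (+ 1 * (b * d) + rest) + (a - b) * d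
  shift = solve-∀

⟦_⟧ : Bool → ℤ
⟦ b ⟧ = if b then + 1 else + 0

charMatrix : (bs : List Bool) → ℤ → Matrix (length bs)
charMatrix bs x r c = (if toℕ r ℕ.≡ᵇ toℕ c then x else + 0) - adjMatrix bs r c

-- Rows 0 and 1 of x I - A agree beyond column 1 and differ there by (x + b₂, -(x + b₂)).
-- After subtracting them, the two surviving minors are, up to the corner entry, the
-- characteristic matrix of the graph without v₁.
thresholdCharPoly-∷∷ : ∀ x b₁ b₂ t → thresholdCharPoly (b₁ ∷ b₂ ∷ t) x ≡
  (x + ⟦ b₂ ⟧) * (+ 2 * thresholdCharPoly (b₂ ∷ t) x - (x + ⟦ b₂ ⟧) * thresholdCharPoly t x)
thresholdCharPoly-∷∷ x b₁ b₂ t = begin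
  det (suc (suc n)) C                   ≡⟨ det-subtractRow n C ⟩
  det (suc (suc n)) (w Vec.∷ tail C)
    ≡⟨ cong₂ (λ d z → + 1 * ((x - + 0 - (+ 0 - β)) * P₁) + (- (+ 1) * ((+ 0 - β - (x - + 0)) * d) + z))
             minor₁ rest-vanishes ⟩
  + 1 * ((x - + 0 - (+ 0 - β)) * P₁) + (- (+ 1) * ((+ 0 - β - (x - + 0)) * (P₁ + (+ 0 - β - (x - + 0)) * P₀)) + + 0)
    ≡⟨ collect x β P₁ P₀ ⟩
  (x + β) * (+ 2 * P₁ - (x + β) * P₀)   ∎
  where
  open ≡-Reasoning
  n : ℕ
  n = length t
  β P₁ P₀ : ℤ
  β = ⟦ b₂ ⟧
  P₁ = thresholdCharPoly (b₂ ∷ t) x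
  P₀ = thresholdCharPoly t x
  C : Matrix (suc (suc n))
  C = charMatrix (b₁ ∷ b₂ ∷ t) x
  w : Fin (suc (suc n)) → ℤ
  w c = C zero c - C (suc zero) c
  minor₁ : det (suc n) (minor (suc zero) (w Vec.∷ tail C)) ≡ P₁ + (+ 0 - β - (x - + 0)) * P₀
  minor₁ = det-corner n (minor (suc zero) (w Vec.∷ tail C)) (charMatrix (b₂ ∷ t) x) rows (λ _ → refl)
    where
    rows : ∀ r c → minor (suc zero) (w Vec.∷ tail C) (suc r) c ≡ charMatrix (b₂ ∷ t) x (suc r) c
    rows r zero    = refl
    rows r (suc c) = refl
  rest-vanishes : sumFin n (λ j → sgn (toℕ (suc (suc j))) * (w (suc (suc j)) * det (suc n) (minor (suc (suc j)) (w Vec.∷ tail C)))) ≡ + 0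
  rest-vanishes = trans (sumFin≡sum n _) (trans (sum-cong-≗ vanishes) (sum-replicate-zero n))
    where
    vanishes : ∀ j → sgn (toℕ (suc (suc j))) * (w (suc (suc j)) * det (suc n) (minor (suc (suc j)) (w Vec.∷ tail C))) ≡ + 0
    vanishes j rewrite +-inverseʳ (C zero (suc (suc j)))
                     | *-zeroˡ (det (suc n) (minor (suc (suc j)) (w Vec.∷ tail C)))
                     = *-zeroʳ (sgn (suc (suc (toℕ j))))
  collect : ∀ x β P₁ P₀ →
    + 1 * ((x - + 0 - (+ 0 - β)) * P₁) + (- (+ 1) * ((+ 0 - β - (x - + 0)) * (P₁ + (+ 0 - β - (x - + 0)) * P₀)) + + 0)
    ≡ (x + β) * (+ 2 * P₁ - (x + β) * P₀)
  collect = solve-∀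

thresholdCharPoly-single : ∀ x b → thresholdCharPoly (b ∷ []) x ≡ x
thresholdCharPoly-single x b = expand x
  where
  expand : ∀ x → + 1 * ((x - + 0) * + 1) + + 0 ≡ x
  expand = solve-∀

thresholdCharPoly-head : ∀ x b t → thresholdCharPoly (b ∷ t) x ≡ thresholdCharPoly (false ∷ t) x
thresholdCharPoly-head x b []       = refl
thresholdCharPoly-head x b (c ∷ t) =
  trans (thresholdCharPoly-∷∷ x b c t) (sym (thresholdCharPoly-∷∷ x false c t))

runHead runTail : ℤ → ℤ → ℤ → ℤ → ℤ
runHead a M f g = a * ((M + + 2) * f - (M + + 1) * a * g)
runTail a M f g = (M + + 1) * f - M * a * g

module Run (x : ℤ) (c : Bool) (t : List Bool) where
  a A B : ℤ
  a = x + ⟦ c ⟧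
  A = thresholdCharPoly (false ∷ t) x
  B = thresholdCharPoly t x

  -- On a run the recurrence has characteristic polynomial (X - a)², whence the closed form.
  thresholdCharPoly-run : ∀ m →
    thresholdCharPoly (false ∷ replicate (suc m) c ++ t) x ≡ a ^ m * runHead a (+ m) A B ×
    thresholdCharPoly (replicate (suc m) c ++ t) x ≡ a ^ m * runTail a (+ m) A B
  thresholdCharPoly-run zero =
      trans (thresholdCharPoly-∷∷ x false c t)
        (trans (cong (λ z → a * (+ 2 * z - a * B)) (thresholdCharPoly-head x c t)) (base₁ a A B))
    , trans (thresholdCharPoly-head x c t) (base₂ a A B)
    where
    base₁ : ∀ a A B → a * (+ 2 * A - a * B) ≡ + 1 * (a * ((+ 0 + + 2) * A - (+ 0 + + 1) * a * B))
    base₁ = solve-∀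
    base₂ : ∀ a A B → A ≡ + 1 * ((+ 0 + + 1) * A - + 0 * a * B)
    base₂ = solve-∀
  thresholdCharPoly-run (suc m) =
    let F≡ , G≡ = thresholdCharPoly-run m in
      trans (thresholdCharPoly-∷∷ x false c (replicate (suc m) c ++ t))
        (trans (cong₂ (λ F G → a * (+ 2 * F - a * G))
                  (trans (thresholdCharPoly-head x c (replicate (suc m) c ++ t)) F≡) G≡)
               (step₁ a (a ^ m) A B (+ m)))
    , trans (thresholdCharPoly-head x c (replicate (suc m) c ++ t)) (trans F≡ (step₂ a (a ^ m) A B (+ m)))
    where
    step₁ : ∀ a p A B M →
      a * (+ 2 * (p * (a * ((M + + 2) * A - (M + + 1) * a * B))) - a * (p * ((M + + 1) * A - M * a * B)))
      ≡ a * p * (a * (((+ 1 + M) + + 2) * A - ((+ 1 + M) + + 1) * a * B))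
    step₁ = solve-∀
    step₂ : ∀ a p A B M →
      p * (a * ((M + + 2) * A - (M + + 1) * a * B)) ≡ a * p * (((+ 1 + M) + + 1) * A - (+ 1 + M) * a * B)
    step₂ = solve-∀

  thresholdCharPoly-run-scaled : ∀ m P f g → A ≡ P * f → B ≡ P * g →
    thresholdCharPoly (false ∷ replicate (suc m) c ++ t) x ≡ P * a ^ m * runHead a (+ m) f g ×
    thresholdCharPoly (replicate (suc m) c ++ t) x ≡ P * a ^ m * runTail a (+ m) f g
  thresholdCharPoly-run-scaled m P f g A≡ B≡ =
    let F≡ , G≡ = thresholdCharPoly-run m in
      trans F≡ (trans (cong₂ (λ A B → a ^ m * runHead a (+ m) A B) A≡ B≡) (scale₁ a (a ^ m) (+ m) P f g))
    , trans G≡ (trans (cong₂ (λ A B → a ^ m * runTail a (+ m) A B) A≡ B≡) (scale₂ a (a ^ m) (+ m) P f g))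
    where
    scale₁ : ∀ a p M P f g →
      p * (a * ((M + + 2) * (P * f) - (M + + 1) * a * (P * g))) ≡ P * p * (a * ((M + + 2) * f - (M + + 1) * a * g))
    scale₁ = solve-∀
    scale₂ : ∀ a p M P f g →
      p * ((M + + 1) * (P * f) - M * a * (P * g)) ≡ P * p * ((M + + 1) * f - M * a * g)
    scale₂ = solve-∀

-- A run (c , m) stands for the block c^(m+1) of the binary sequence.
runs : List (Bool × ℕ) → List Bool
runs []             = []
runs ((c , m) ∷ rs) = replicate (suc m) c ++ runs rs

runsWeight : ℤ → List (Bool × ℕ) → ℤ
runsWeight x []             = + 1
runsWeight x ((c , m) ∷ rs) = runsWeight x rs * (x + ⟦ c ⟧) ^ m

runsTransfer : ℤ → List (Bool × ℕ) → ℤ × ℤ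
runsTransfer x []             = x , + 1
runsTransfer x ((c , m) ∷ rs) =
  runHead (x + ⟦ c ⟧) (+ m) (proj₁ fg) (proj₂ fg) , runTail (x + ⟦ c ⟧) (+ m) (proj₁ fg) (proj₂ fg)
  where
  fg : ℤ × ℤ
  fg = runsTransfer x rs

thresholdCharPoly-runs : ∀ x rs →
  thresholdCharPoly (false ∷ runs rs) x ≡ runsWeight x rs * proj₁ (runsTransfer x rs) ×
  thresholdCharPoly (runs rs) x ≡ runsWeight x rs * proj₂ (runsTransfer x rs)
thresholdCharPoly-runs x []             = trans (thresholdCharPoly-single x false) (sym (*-identityˡ x)) , refl
thresholdCharPoly-runs x ((c , m) ∷ rs) =
  let A≡ , B≡ = thresholdCharPoly-runs x rs in
  Run.thresholdCharPoly-run-scaled x c (runs rs) m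
    (runsWeight x rs) (proj₁ (runsTransfer x rs)) (proj₂ (runsTransfer x rs)) A≡ B≡

G'-runs : ℕ → List (Bool × ℕ)
G'-runs k = (true , k ℕ.+ (k ℕ.+ 1)) ∷ (false , k ℕ.+ 1) ∷ (true , k ℕ.+ (k ℕ.+ 1)) ∷ (false , k ℕ.+ (k ℕ.+ 2))
          ∷ (true , k ℕ.+ (k ℕ.+ 3)) ∷ []

seqG'-runs : ∀ k → seqG' (suc k) ≡ false ∷ runs (G'-runs k)
seqG'-runs k = cong (false ∷_)
  (cong₂ _++_ (cong (λ n → replicate n true) (e₁ k))
  (cong₂ _++_ (cong (λ n → replicate n false) (e₂ k))
  (cong₂ _++_ (cong (λ n → replicate n true) (e₁ k))
  (cong₂ _++_ (cong (λ n → replicate n false) (e₃ k))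
    (trans (cong (λ n → replicate n true) (e₄ k)) (sym (++-identityʳ _)))))))
  where
  e₁ : ∀ k → 2 ℕ.* suc k ≡ suc (k ℕ.+ (k ℕ.+ 1))
  e₁ = ℕ-solve-∀
  e₂ : ∀ k → suc k ℕ.+ 1 ≡ suc (k ℕ.+ 1)
  e₂ = ℕ-solve-∀
  e₃ : ∀ k → 2 ℕ.* suc k ℕ.+ 1 ≡ suc (k ℕ.+ (k ℕ.+ 2))
  e₃ = ℕ-solve-∀
  e₄ : ∀ k → 2 ℕ.* suc k ℕ.+ 2 ≡ suc (k ℕ.+ (k ℕ.+ 3))
  e₄ = ℕ-solve-∀

-- solve-∀ neither unfolds definitions nor reads _^_, so runHead, runTail and the powers
-- are restated as local definitions, definitionally equal to the original ones.
runsTransfer-G' : ∀ x K →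
  let H : ℤ → ℤ → ℤ → ℤ → ℤ
      H a M f g = a * ((M + + 2) * f - (M + + 1) * a * g)
      T : ℤ → ℤ → ℤ → ℤ → ℤ
      T a M f g = (M + + 1) * f - M * a * g
      a = x + + 1 ; b = x + + 0
      M₁ = K + (K + + 1) ; M₂ = K + + 1 ; M₄ = K + (K + + 2) ; M₅ = K + (K + + 3)
      f₅ = H a M₅ x (+ 1) ; g₅ = T a M₅ x (+ 1)
      f₄ = H b M₄ f₅ g₅   ; g₄ = T b M₄ f₅ g₅
      f₃ = H a M₁ f₄ g₄   ; g₃ = T a M₁ f₄ g₄
      f₂ = H b M₂ f₃ g₃   ; g₂ = T b M₂ f₃ g₃
      n = + 1 + K
      x² = x * (x * + 1) ; x³ = x * x² ; x⁴ = x * x³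
      n² = n * (n * + 1) ; n³ = n * n² ; n⁴ = n * n³
  in H a M₁ f₂ g₂ ≡ a * (x + (+ 2 * n + + 2)) *
       ( x⁴
       - (+ 8 * n + + 2) * x³
       - (- (+ 8) * n² + + 4 * n + + 3) * x²
       - (- (+ 8) * n³ - + 20 * n² - + 8 * n) * x
       - + 8 * n⁴ - + 12 * n³ - + 4 * n² )
runsTransfer-G' = solve-∀

runsWeight-G' : ∀ k x → runsWeight x (G'-runs k) * (x + + 1) ≡ x ^ (3 ℕ.* suc k) * (x + + 1) ^ (6 ℕ.* suc k)
runsWeight-G' k x = begin
  + 1 * a ^ m₅ * (x + + 0) ^ m₄ * a ^ m₁ * (x + + 0) ^ m₂ * a ^ m₁ * a
    ≡⟨ cong (λ b → + 1 * a ^ m₅ * b ^ m₄ * a ^ m₁ * b ^ m₂ * a ^ m₁ * a) (+-identityʳ x) ⟩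
  + 1 * a ^ m₅ * x ^ m₄ * a ^ m₁ * x ^ m₂ * a ^ m₁ * a
    ≡⟨ regroup (a ^ m₅) (x ^ m₄) (a ^ m₁) (x ^ m₂) a ⟩
  x ^ m₄ * x ^ m₂ * (a ^ m₅ * (a ^ m₁ * (a ^ m₁ * a ^ 1)))
    ≡⟨ sym (cong₂ _*_ (^-distribˡ-+-* x m₄ m₂)
         (trans (^-distribˡ-+-* a m₅ (m₁ ℕ.+ (m₁ ℕ.+ 1)))
           (cong (a ^ m₅ *_) (trans (^-distribˡ-+-* a m₁ (m₁ ℕ.+ 1)) (cong (a ^ m₁ *_) (^-distribˡ-+-* a m₁ 1)))))) ⟩
  x ^ (m₄ ℕ.+ m₂) * a ^ (m₅ ℕ.+ (m₁ ℕ.+ (m₁ ℕ.+ 1)))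
    ≡⟨ cong₂ (λ p q → x ^ p * a ^ q) (exponent-x k) (exponent-a k) ⟩
  x ^ (3 ℕ.* suc k) * a ^ (6 ℕ.* suc k) ∎
  where
  open ≡-Reasoning
  a : ℤ
  a = x + + 1
  m₁ m₂ m₄ m₅ : ℕ
  m₁ = k ℕ.+ (k ℕ.+ 1) ; m₂ = k ℕ.+ 1 ; m₄ = k ℕ.+ (k ℕ.+ 2) ; m₅ = k ℕ.+ (k ℕ.+ 3)
  regroup : ∀ p q r s a → + 1 * p * q * r * s * r * a ≡ q * s * (p * (r * (r * (a * + 1))))
  regroup = solve-∀
  exponent-x : ∀ k → k ℕ.+ (k ℕ.+ 2) ℕ.+ (k ℕ.+ 1) ≡ 3 ℕ.* suc k
  exponent-x = ℕ-solve-∀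
  exponent-a : ∀ k → k ℕ.+ (k ℕ.+ 3) ℕ.+ (k ℕ.+ (k ℕ.+ 1) ℕ.+ (k ℕ.+ (k ℕ.+ 1) ℕ.+ 1)) ≡ 6 ℕ.* suc k
  exponent-a = ℕ-solve-∀

thresholdCharPoly-G' : ∀ k x → thresholdCharPoly (seqG' (suc k)) x ≡ rhsG' (suc k) x
thresholdCharPoly-G' k x =
  trans (cong (λ s → thresholdCharPoly s x) (seqG'-runs k))
  (trans (proj₁ (thresholdCharPoly-runs x (G'-runs k)))
  (trans (cong (runsWeight x (G'-runs k) *_) (runsTransfer-G' x (+ k)))
         (factor (runsWeight x (G'-runs k)) (x + + 1) (runsWeight-G' k x))))
  where
  factor : ∀ W a {L Q W'} → W * a ≡ W' → W * (a * L * Q) ≡ W' * L * Q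
  factor W a {L} {Q} refl = reassoc W a L Q
    where
    reassoc : ∀ W a L Q → W * (a * L * Q) ≡ W * a * L * Q
    reassoc = solve-∀

lemma5 : (i : ℕ) → i ≥ 1 →
    Σ ℤ (λ s → (s ≡ + 1 ⊎ s ≡ - (+ 1)) ×
      ((x : ℤ) → thresholdCharPoly (seqG' i) x ≡ s * rhsG' i x))
lemma5 zero    ()
lemma5 (suc k) _ =
  + 1 , inj₁ refl , λ x → trans (thresholdCharPoly-G' k x) (sym (*-identityˡ (rhsG' (suc k) x)))
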